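{- If a connected graph $H$ contains a simple dominating vertex, then any graph $G$ that covers $H$ contains a 1-perfect code.
   Context: A graph has finite vertex and edge sets; every edge is a normal edge (two distinct end-vertices, adding 1 to each degree), a loop (one vertex, adding 2 to its degree) or a semi-edge (one vertex, adding 1 to its degree); multiple loops, semi-edges and parallel edges are allowed. A simple dominating vertex of $H$ is a vertex $u$ adjacent (via a normal edge) to every other vertex of $H$, incident with no loops and no semi-edges, and not incident with any multiple (parallel) normal edges. A 1-perfect code in $G$ is an independent set $C$ of vertices (no normal edge, loop, or semi-edge lies inside $C$ in the sense that no two vertices of $C$ are adjacent and no vertex of $C$ carries a loop) such that every vertex of $V(G)\setminus C$ has exactly one neighbor in $C$. $G$ covers $H$ if there are surjective maps $f_V:V(G)\to V(H)$, $f_E:E(G)\to E(H)$ with $f_V$ degree preserving, $f_E$ mapping semi-edges onto semi-edges and loops onto loops (normal edges may go to normal edges, loops or semi-edges), $f_E$ incidence preserving, and $f_E$ a local bijection between edge-neighborhoods of each vertex and its image (so the preimage of a normal edge $uv$ is a perfect matching between $f_V^{ -1}(u)$ and $f_V^{ -1}(v)$). -}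

module Defs where

open import Data.Nat using (ℕ; zero; suc; _+_)
open import Data.Fin using (Fin; zero; suc; _≟_)
open import Data.Fin.Subset using (Subset; _∈_; _∉_)
open import Data.List using (List; map; allFin)
open import Data.Nat.ListAction using (sum)
open import Data.Product using (Σ; ∃; _×_; _,_; proj₁)
open import Data.Sum using (_⊎_)
open import Data.Empty using (⊥)
open import Data.Unit using (⊤)
open import Relation.Binary.PropositionalEquality using (_≡_; _≢_)
open import Relation.Nullary using (¬_; yes; no)
open import Function.Bundles using (Bijection; _⤖_)

-- The end-vertices of an edge: a normal edge (two end-vertices),
-- a loop (one vertex, counted twice), or a semi-edge (one vertex, counted once).
data Ends (V : Set) : Set where
  normal : V → V → Ends V
  loop   : V → Ends V
  semi   : V → Ends V

record Graph : Set where
  field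
    nV : ℕ
    nE : ℕ
    ends : Fin nE → Ends (Fin nV)
    normal-distinct : ∀ e u v → ends e ≡ normal u v → u ≢ v

open Graph public

Vertex : Graph → Set
Vertex G = Fin (nV G)

Edge : Graph → Set
Edge G = Fin (nE G)

contrib : ∀ {n} → Ends (Fin n) → Fin n → ℕ
contrib (normal u v) x = (one u x) + (one v x)
  where
  one : ∀ {n} → Fin n → Fin n → ℕ
  one a b with a ≟ b
  ... | yes _ = 1
  ... | no _ = 0
contrib (loop u) x with u ≟ x
... | yes _ = 2
... | no _ = 0
contrib (semi u) x with u ≟ x
... | yes _ = 1
... | no _ = 0

deg : (G : Graph) → Vertex G → ℕ
deg G x = sum (map (λ e → contrib (ends G e) x) (allFin (nE G)))

-- The edge-neighbourhood of a vertex x is the set of darts at x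
-- (so a loop at x appears twice, matching its degree contribution 2).
arity : ∀ {V : Set} → Ends V → ℕ
arity (normal _ _) = 2
arity (loop _) = 2
arity (semi _) = 1

dartEnd : ∀ {V : Set} (x : Ends V) → Fin (arity x) → V
dartEnd (normal u v) zero = u
dartEnd (normal u v) (suc _) = v
dartEnd (loop u) _ = u
dartEnd (semi u) _ = u

Dart : Graph → Set
Dart G = Σ (Edge G) (λ e → Fin (arity (ends G e)))

dartVertex : (G : Graph) → Dart G → Vertex G
dartVertex G (e , i) = dartEnd (ends G e) i

DartsAt : (G : Graph) → Vertex G → Set
DartsAt G x = Σ (Dart G) (λ d → dartVertex G d ≡ x)

KindOK : ∀ {V W : Set} → Ends V → Ends W → Set
KindOK (normal _ _) _ = ⊤
KindOK (loop _) (loop _) = ⊤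
KindOK (loop _) _ = ⊥
KindOK (semi _) (semi _) = ⊤
KindOK (semi _) _ = ⊥

Incid : ∀ {V W : Set} → (V → W) → Ends V → Ends W → Set
Incid f (normal u v) (normal a b) = (f u ≡ a × f v ≡ b) ⊎ (f u ≡ b × f v ≡ a)
Incid f (normal u v) (loop w) = f u ≡ w × f v ≡ w
Incid f (normal u v) (semi w) = f u ≡ w × f v ≡ w
Incid f (loop u) (loop w) = f u ≡ w
Incid f (loop u) _ = ⊥
Incid f (semi u) (semi w) = f u ≡ w
Incid f (semi u) _ = ⊥

record Covers (G H : Graph) : Set where
  field
    fV : Vertex G → Vertex H
    fE : Edge G → Edge H
    fV-surjective : ∀ y → ∃ λ x → fV x ≡ y
    fE-surjective : ∀ h → ∃ λ e → fE e ≡ h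
    degree-preserving : ∀ x → deg G x ≡ deg H (fV x)
    kinds : ∀ e → KindOK (ends G e) (ends H (fE e))
    incidence : ∀ e → Incid fV (ends G e) (ends H (fE e))
    local-bijection : ∀ x → Σ (DartsAt G x ⤖ DartsAt H (fV x)) λ φ →
      ∀ d → proj₁ (proj₁ (Bijection.to φ d)) ≡ fE (proj₁ (proj₁ d))

Joins : (G : Graph) → Edge G → Vertex G → Vertex G → Set
Joins G e u v = (ends G e ≡ normal u v) ⊎ (ends G e ≡ normal v u)

Adj : (G : Graph) → Vertex G → Vertex G → Set
Adj G u v = ∃ λ e → Joins G e u v

data Reachable (G : Graph) : Vertex G → Vertex G → Set where
  here : ∀ {u} → Reachable G u u
  step : ∀ {u w v} → Adj G u w → Reachable G w v → Reachable G u v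

Connected : Graph → Set
Connected G = ∀ u v → Reachable G u v

SimpleDominating : (H : Graph) → Vertex H → Set
SimpleDominating H u =
  (∀ v → v ≢ u → Σ (Edge H) λ e → Joins H e u v × (∀ e' → Joins H e' u v → e' ≡ e))
  × (∀ e → ends H e ≢ loop u)
  × (∀ e → ends H e ≢ semi u)

record PerfectCode (G : Graph) (C : Subset (nV G)) : Set where
  field
    independent : ∀ u v → u ∈ C → v ∈ C → ¬ Adj G u v
    no-loops : ∀ u → u ∈ C → ∀ e → ends G e ≢ loop u
    unique-neighbour : ∀ v → v ∉ C →
      Σ (Vertex G) λ c → c ∈ C × Adj G v c × (∀ c' → c' ∈ C → Adj G v c' → c' ≡ c)

{-# OPTIONS --safe #-}
module Submission where

-- The code is the fibre C of fV over the simple dominating vertex u.  An edge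
-- inside C would map onto a normal edge from u to u, a loop or a semi-edge at u,
-- and none of these exist.  For v over w ≠ u, the unique edge of H joining u and w
-- has exactly one dart at w, which the local bijection at v lifts to exactly one
-- dart at v.  Every edge from v into C maps onto that edge of H, and only normal
-- edges cover a normal edge, so the lifted dart lies on the one and only edge from
-- v into C.

open import Defs
open import Data.Empty using (⊥-elim)
open import Data.Fin using (Fin; zero; suc; _≟_)
open import Data.Fin.Subset using (Subset; _∈_; _∉_)
open import Data.Product using (Σ; ∃; _×_; _,_; proj₁; proj₂)
import Data.Product as Product
open import Data.Sum using (_⊎_; inj₁; inj₂; swap)
import Data.Sum as Sum
open import Data.Vec using (tabulate)
open import Data.Vec.Properties using (lookup∘tabulate; []=⇒lookup; lookup⇒[]=)
open import Function using (id; _∘_)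
open import Function.Bundles using (Bijection)
open import Function.Definitions using (Injective)
open import Relation.Binary.PropositionalEquality using (_≡_; _≢_; refl; sym; trans; cong; cong₂; subst)
open import Relation.Nullary using (¬_; yes; no; does)
open import Relation.Nullary.Decidable using (dec-true)
open import Axiom.UniquenessOfIdentityProofs using (module Decidable⇒UIP)

fibre : ∀ {m n} → (Fin m → Fin n) → Fin n → Subset m
fibre f y = tabulate λ x → does (f x ≟ y)

module _ {m n} (f : Fin m → Fin n) {x : Fin m} {y : Fin n} where

  ∈-fibre⁺ : f x ≡ y → x ∈ fibre f y
  ∈-fibre⁺ fx≡y = lookup⇒[]= x _ (trans (lookup∘tabulate _ x) (dec-true (f x ≟ y) fx≡y))

  ∈-fibre⁻ : x ∈ fibre f y → f x ≡ y
  ∈-fibre⁻ x∈ with f x ≟ y | trans (sym (lookup∘tabulate _ x)) ([]=⇒lookup x∈)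
  ... | yes fx≡y | _ = fx≡y
  ... | no _     | ()

normal-dartEnd-injective : ∀ {V : Set} {a b : V} → a ≢ b → Injective _≡_ _≡_ (dartEnd (normal a b))
normal-dartEnd-injective _   {zero}     {zero}     _ = refl
normal-dartEnd-injective a≢b {zero}     {suc zero} p = ⊥-elim (a≢b p)
normal-dartEnd-injective a≢b {suc zero} {zero}     p = ⊥-elim (a≢b (sym p))
normal-dartEnd-injective _   {suc zero} {suc zero} _ = refl

-- Joins G e a b is Links (ends G e) a b by definition.
Links : ∀ {V : Set} → Ends V → V → V → Set
Links x a b = x ≡ normal a b ⊎ x ≡ normal b a

module _ {V : Set} {x : Ends V} where

  links-sym : ∀ {a b} → Links x a b → Links x b a
  links-sym = swap

  links-other-end-unique : ∀ {a b b′} → Links x a b → Links x a b′ → b ≡ b′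
  links-other-end-unique (inj₁ refl) (inj₁ refl) = refl
  links-other-end-unique (inj₁ refl) (inj₂ refl) = refl
  links-other-end-unique (inj₂ refl) (inj₁ refl) = refl
  links-other-end-unique (inj₂ refl) (inj₂ refl) = refl

  links-dart : ∀ {a b} → Links x a b → Σ (Fin (arity x)) λ i → dartEnd x i ≡ a
  links-dart (inj₁ refl) = zero , refl
  links-dart (inj₂ refl) = suc zero , refl

  links-dartEnd-injective : ∀ {a b} → Links x a b → a ≢ b → Injective _≡_ _≡_ (dartEnd x)
  links-dartEnd-injective (inj₁ refl) a≢b = normal-dartEnd-injective a≢b
  links-dartEnd-injective (inj₂ refl) a≢b = normal-dartEnd-injective (a≢b ∘ sym)

-- Only a normal edge can be mapped onto a normal edge.
dartEnd-links : ∀ {V W : Set} {x : Ends V} {y : Ends W} {a b : W} {v : V} →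
  KindOK x y → Links y a b → (i : Fin (arity x)) → dartEnd x i ≡ v → ∃ (Links x v)
dartEnd-links {y = loop _} _ (inj₁ ()) _ _
dartEnd-links {y = loop _} _ (inj₂ ()) _ _
dartEnd-links {y = semi _} _ (inj₁ ()) _ _
dartEnd-links {y = semi _} _ (inj₂ ()) _ _
dartEnd-links {x = normal _ q} {normal _ _} _ _ zero       refl = q , inj₁ refl
dartEnd-links {x = normal p _} {normal _ _} _ _ (suc zero) refl = p , inj₂ refl
dartEnd-links {x = loop _}     {normal _ _} () _ _ _
dartEnd-links {x = semi _}     {normal _ _} () _ _ _

module _ {V W : Set} (f : V → W) where

  incid-normal-swap : ∀ {y a b} → Incid f (normal a b) y → Incid f (normal b a) y
  incid-normal-swap {y = normal _ _} = swap ∘ Sum.map Product.swap Product.swap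
  incid-normal-swap {y = loop _}     = Product.swap
  incid-normal-swap {y = semi _}     = Product.swap

  incid-links : ∀ {y x a b} → Links x a b → Incid f x y → Incid f (normal a b) y
  incid-links (inj₁ refl) = id
  incid-links (inj₂ refl) = incid-normal-swap

  incid-loop : ∀ {y c} → Incid f (loop c) y → y ≡ loop (f c)
  incid-loop {y = loop _} fc≡z = cong loop (sym fc≡z)

  incid-normal-within : ∀ {y a b t} → Incid f (normal a b) y → f a ≡ t → f b ≡ t →
    y ≡ normal t t ⊎ y ≡ loop t ⊎ y ≡ semi t
  incid-normal-within {y = normal _ _} (inj₁ (p , q)) refl fb = inj₁ (cong₂ normal (sym p) (trans (sym q) fb))
  incid-normal-within {y = normal _ _} (inj₂ (p , q)) refl fb = inj₁ (cong₂ normal (trans (sym q) fb) (sym p))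
  incid-normal-within {y = loop _}     (p , _)        refl _  = inj₂ (inj₁ (cong loop (sym p)))
  incid-normal-within {y = semi _}     (p , _)        refl _  = inj₂ (inj₂ (cong semi (sym p)))

  incid-normal-across : ∀ {y a b p q} →
    Incid f (normal a b) y → f a ≡ p → f b ≡ q → p ≢ q → Links y p q
  incid-normal-across {y = normal _ _} (inj₁ (refl , refl)) refl refl _ = inj₁ refl
  incid-normal-across {y = normal _ _} (inj₂ (refl , refl)) refl refl _ = inj₂ refl
  incid-normal-across {y = loop _}     (p , q) refl refl p≢q = ⊥-elim (p≢q (trans p (sym q)))
  incid-normal-across {y = semi _}     (p , q) refl refl p≢q = ⊥-elim (p≢q (trans p (sym q)))

  incid-normal-opposite : ∀ {y a b p q} →
    Incid f (normal a b) y → Links y p q → p ≢ q → f a ≡ q → f b ≡ p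
  incid-normal-opposite (inj₁ (fa≡p , _)) (inj₁ refl) p≢q fa≡q = ⊥-elim (p≢q (trans (sym fa≡p) fa≡q))
  incid-normal-opposite (inj₂ (_ , fb≡p)) (inj₁ refl) _   _    = fb≡p
  incid-normal-opposite (inj₁ (_ , fb≡p)) (inj₂ refl) _   _    = fb≡p
  incid-normal-opposite (inj₂ (fa≡p , _)) (inj₂ refl) p≢q fa≡q = ⊥-elim (p≢q (trans (sym fa≡p) fa≡q))

dartEdge : (K : Graph) {w : Vertex K} → DartsAt K w → Edge K
dartEdge _ = proj₁ ∘ proj₁

link-darts-unique : ∀ (K : Graph) {h : Edge K} {a b w : Vertex K} → Links (ends K h) a b →
  (d d′ : DartsAt K w) → dartEdge K d ≡ h → dartEdge K d′ ≡ h → d ≡ d′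
link-darts-unique K {h} a~b ((.h , i) , i-at-w) ((.h , j) , j-at-w) refl refl
  with links-dartEnd-injective a~b (link-ends-distinct a~b) (trans i-at-w (sym j-at-w))
  where
  link-ends-distinct : ∀ {a b} → Links (ends K h) a b → a ≢ b
  link-ends-distinct (inj₁ h↦ab) = normal-distinct K h _ _ h↦ab
  link-ends-distinct (inj₂ h↦ba) = normal-distinct K h _ _ h↦ba ∘ sym
... | refl = cong ((h , i) ,_) (Decidable⇒UIP.≡-irrelevant _≟_ i-at-w j-at-w)

module Covering {G H : Graph} (cov : Covers G H) where
  open Covers cov

  private
    module Local (v : Vertex G) = Bijection (proj₁ (local-bijection v))

    to-dartEdge : ∀ {v} (d : DartsAt G v) → dartEdge H (Local.to v d) ≡ fE (dartEdge G d)
    to-dartEdge {v} = proj₂ (local-bijection v)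

  dart-over-link : ∀ {h a v} → Links (ends H h) a (fV v) → Σ (DartsAt G v) λ d → fE (dartEdge G d) ≡ h
  dart-over-link {h} {v = v} a~w =
    let (i , i-at-w) = links-dart (links-sym a~w)
        (d , d↦target) = Local.strictlySurjective v ((h , i) , i-at-w)
    in d , trans (sym (to-dartEdge d)) (cong (dartEdge H) d↦target)

  darts-over-link-unique : ∀ {h a b v} → Links (ends H h) a b → (d d′ : DartsAt G v) →
    fE (dartEdge G d) ≡ h → fE (dartEdge G d′) ≡ h → d ≡ d′
  darts-over-link-unique {v = v} a~b d d′ d↦h d′↦h = Local.injective v
    (link-darts-unique H a~b (Local.to v d) (Local.to v d′)
      (trans (to-dartEdge d) d↦h) (trans (to-dartEdge d′) d′↦h))

  edges-over-link-unique : ∀ {h a b e e′ v c c′} → Links (ends H h) a b →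
    Joins G e v c → Joins G e′ v c′ → fE e ≡ h → fE e′ ≡ h → e ≡ e′
  edges-over-link-unique {e = e} {e′} a~b v~c v~c′ e↦h e′↦h = cong (dartEdge G)
    (darts-over-link-unique a~b (dart-at-v e v~c) (dart-at-v e′ v~c′) e↦h e′↦h)
    where
    dart-at-v : ∀ {v c} e → Joins G e v c → DartsAt G v
    dart-at-v e v~c = (e , proj₁ (links-dart v~c)) , proj₂ (links-dart v~c)

  lift-link : ∀ {h a v} → Links (ends H h) a (fV v) → a ≢ fV v → ∃ λ c → fV c ≡ a × Adj G v c
  lift-link {a = a} {v} a~w a≢w =
    let (((e , i) , i-at-v) , e↦h) = dart-over-link a~w
        e-image = subst (λ k → Links (ends H k) a (fV v)) (sym e↦h) a~w
        (c , v~c) = dartEnd-links (kinds e) e-image i i-at-v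
    in c , incid-normal-opposite fV (incid-links fV v~c (incidence e)) e-image a≢w refl , e , v~c

  joins-image : ∀ {e a b p q} → Joins G e a b → fV a ≡ p → fV b ≡ q → p ≢ q → Joins H (fE e) p q
  joins-image {e} a~b = incid-normal-across fV (incid-links fV a~b (incidence e))

  joins-within-fibre : ∀ {e a b t} → Joins G e a b → fV a ≡ t → fV b ≡ t →
    ends H (fE e) ≡ normal t t ⊎ ends H (fE e) ≡ loop t ⊎ ends H (fE e) ≡ semi t
  joins-within-fibre {e} a~b = incid-normal-within fV (incid-links fV a~b (incidence e))

  loop-image : ∀ {e c} → ends G e ≡ loop c → ends H (fE e) ≡ loop (fV c)
  loop-image {e} e↦c = incid-loop fV (subst (λ x → Incid fV x (ends H (fE e))) e↦c (incidence e))

module DominatingFibre {G H : Graph} (cov : Covers G H) {u : Vertex H} (sd : SimpleDominating H u) where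
  open Covers cov
  open Covering cov

  C : Subset (nV G)
  C = fibre fV u

  private
    spoke : ∀ {w} → w ≢ u → Edge H
    spoke w≢u = proj₁ (proj₁ sd _ w≢u)

    spoke-joins : ∀ {w} (w≢u : w ≢ u) → Joins H (spoke w≢u) u w
    spoke-joins w≢u = proj₁ (proj₂ (proj₁ sd _ w≢u))

    spoke-unique : ∀ {w h} (w≢u : w ≢ u) → Joins H h u w → h ≡ spoke w≢u
    spoke-unique w≢u = proj₂ (proj₂ (proj₁ sd _ w≢u)) _

    no-loop : ∀ h → ends H h ≢ loop u
    no-loop = proj₁ (proj₂ sd)

    no-semi : ∀ h → ends H h ≢ semi u
    no-semi = proj₂ (proj₂ sd)

  fibre-independent : ∀ a b → a ∈ C → b ∈ C → ¬ Adj G a b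
  fibre-independent a b a∈C b∈C (e , a~b)
    with joins-within-fibre a~b (∈-fibre⁻ fV a∈C) (∈-fibre⁻ fV b∈C)
  ... | inj₁ e↦uu          = normal-distinct H (fE e) u u e↦uu refl
  ... | inj₂ (inj₁ e↦loop) = no-loop (fE e) e↦loop
  ... | inj₂ (inj₂ e↦semi) = no-semi (fE e) e↦semi

  fibre-loop-free : ∀ c → c ∈ C → ∀ e → ends G e ≢ loop c
  fibre-loop-free c c∈C e e↦c = no-loop (fE e) (trans (loop-image e↦c) (cong loop (∈-fibre⁻ fV c∈C)))

  fibre-edge-over-spoke : ∀ {v c e} (w≢u : fV v ≢ u) → c ∈ C → Joins G e v c → fE e ≡ spoke w≢u
  fibre-edge-over-spoke w≢u c∈C v~c =
    spoke-unique w≢u (links-sym (joins-image v~c refl (∈-fibre⁻ fV c∈C) w≢u))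

  fibre-neighbour : ∀ {v} → fV v ≢ u → ∃ λ c → c ∈ C × Adj G v c
  fibre-neighbour w≢u =
    let (c , c↦u , v~c) = lift-link (spoke-joins w≢u) (w≢u ∘ sym)
    in c , ∈-fibre⁺ fV c↦u , v~c

  fibre-neighbour-unique : ∀ {v c c′} →
    fV v ≢ u → c ∈ C → c′ ∈ C → Adj G v c → Adj G v c′ → c ≡ c′
  fibre-neighbour-unique w≢u c∈C c′∈C (e , v~c) (e′ , v~c′)
    with refl ← edges-over-link-unique (spoke-joins w≢u) v~c v~c′
                  (fibre-edge-over-spoke w≢u c∈C v~c) (fibre-edge-over-spoke w≢u c′∈C v~c′)
    = links-other-end-unique v~c v~c′

  fibre-unique-neighbour : ∀ v → v ∉ C →
    Σ (Vertex G) λ c → c ∈ C × Adj G v c × (∀ c′ → c′ ∈ C → Adj G v c′ → c′ ≡ c)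
  fibre-unique-neighbour v v∉C =
    let w≢u = v∉C ∘ ∈-fibre⁺ fV
        (c , c∈C , v~c) = fibre-neighbour w≢u
    in c , c∈C , v~c , λ c′ c′∈C v~c′ → fibre-neighbour-unique w≢u c′∈C c∈C v~c′ v~c

  fibre-perfectCode : PerfectCode G C
  fibre-perfectCode = record
    { independent      = fibre-independent
    ; no-loops         = fibre-loop-free
    ; unique-neighbour = fibre-unique-neighbour
    }

lemma5 : (H G : Graph) → Connected H → (∃ λ u → SimpleDominating H u) →
    Covers G H → ∃ λ (C : Subset (nV G)) → PerfectCode G C
lemma5 H G _ (u , sd) cov = C , fibre-perfectCode
  where open DominatingFibre cov sd
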